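{- Let $S$ be a finite set of propositional clauses containing at least one literal occurrence. Then $hp(S)\le p(S)$.
   Context: For a variable $v$ and a set of clauses $S$, let $pos(v,S)$ and $neg(v,S)$ denote the number of occurrences in $S$ of the unnegated literal $v$ and of the negated literal $\neg v$, respectively. Let $poslit(S)$ and $neglit(S)$ denote the total number of unnegated and negated literal occurrences in $S$, respectively. The \emph{skewness} of $S$ is $$p(S)=\frac{\min(poslit(S),neglit(S))}{poslit(S)+neglit(S)}.$$ For a subset $\theta$ of the variables of $S$ (an \emph{inverter}), $S\theta$ is the set of clauses obtained from $S$ by inverting every literal whose variable lies in $\theta$, i.e., replacing $v$ with $\neg v$ and $\neg v$ with $v$. Define the inverter $\rho_S=\{v : pos(v,S)>neg(v,S)\}$. The \emph{hidden skewness} of $S$ is $hp(S)=p(S\rho_S)$. -}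

module Defs where

open import Data.Nat using (ℕ; zero; suc; _+_; _<ᵇ_; _≡ᵇ_; _⊔_; _⊓_)
open import Data.Bool using (Bool; true; false; not; if_then_else_; _xor_)
open import Data.List using (List; []; _∷_; map; sum; length)
open import Data.Integer using (+_)
open import Data.Rational using (ℚ; _/_; 0ℚ)

Var : Set
Var = ℕ

record Literal : Set where
  constructor lit
  field
    var : Var
    positive : Bool
open Literal public

-- A clause is a finite collection of literal occurrences; a clause set is a
-- finite collection of clauses.  Occurrences are counted.
Clause : Set
Clause = List Literal

ClauseSet : Set
ClauseSet = List Clause

countC : (Literal → Bool) → Clause → ℕ
countC P [] = 0
countC P (l ∷ c) = (if P l then 1 else 0) + countC P c

count : (Literal → Bool) → ClauseSet → ℕ
count P [] = 0
count P (c ∷ S) = countC P c + count P S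

pos : Var → ClauseSet → ℕ
pos v = count (λ l → (var l ≡ᵇ v) Data.Bool.∧ positive l)

neg : Var → ClauseSet → ℕ
neg v = count (λ l → (var l ≡ᵇ v) Data.Bool.∧ not (positive l))

poslit : ClauseSet → ℕ
poslit = count positive

neglit : ClauseSet → ℕ
neglit = count (λ l → not (positive l))

-- skewness p(S) = min(poslit,neglit)/(poslit+neglit); (value 0 when S has no
-- literal occurrences, a case excluded by the theorem's hypothesis)
skewness : ClauseSet → ℚ
skewness S with poslit S + neglit S
... | zero = 0ℚ
... | suc k = (+ (poslit S ⊓ neglit S)) / suc k

-- An inverter θ, given as a (decidable) characteristic function on variables.
Inverter : Set
Inverter = Var → Bool

invertLit : Inverter → Literal → Literal
invertLit θ (lit v b) = lit v (if θ v then not b else b)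

invert : ClauseSet → Inverter → ClauseSet
invert S θ = map (map (invertLit θ)) S

ρ : ClauseSet → Inverter
ρ S v = neg v S <ᵇ pos v S

hiddenSkewness : ClauseSet → ℚ
hiddenSkewness S = skewness (invert S (ρ S))

module Submission where

-- Split the literal occurrences of S by polarity and by whether their variable lies in the
-- inverter θ. Inverting θ only swaps polarities, so the number of occurrences is unchanged,
-- and poslit(Sθ) = posOut + negIn while poslit S = posOut + posIn and neglit S = negOut + negIn.
-- If every variable in θ occurs at least as often positively as negatively and every other
-- variable at most as often, summing over the variables gives negIn ≤ posIn and posOut ≤ negOut,
-- so min(poslit, neglit)(Sθ) ≤ poslit(Sθ) ≤ min(poslit S, neglit S). By definition ρ_S is such
-- an inverter.

open import Defs
open import Data.Nat using (ℕ; _+_; _<_)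
open import Data.Rational using (_≤_)

open import Data.Bool using (Bool; true; false; not; _∧_; if_then_else_; T)
open import Data.Bool.Properties using (∧-identityʳ; ∧-zeroʳ; T-≡; T-not-≡)
open import Data.List using (List; []; _∷_; _++_; map; concat)
open import Data.List.Relation.Unary.All as All using (All; []; _∷_)
open import Data.Nat as ℕ using (zero; suc; _≡ᵇ_; _<ᵇ_; _⊓_; _⊔_; z≤n)
open import Data.Nat.Properties as ℕ
  using (≤-trans; ≤-reflexive; <⇒≤; ≮⇒≥; <ᵇ⇒<; <⇒<ᵇ; ≡ᵇ⇒≡;
         +-mono-≤; +-monoˡ-≤; +-monoʳ-≤; m⊓n≤m; ⊓-glb; m≤m⊔n; m≤n⊔m; <-≤-trans)
open import Algebra.Properties.CommutativeSemigroup ℕ.+-commutativeSemigroup using (interchange)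
open import Data.Product using (∃-syntax; _,_)
open import Function using (_∘_)
open import Function.Bundles using (Equivalence)
open import Relation.Binary.PropositionalEquality
import Data.Integer as ℤ
import Data.Integer.Properties as ℤ
import Data.Rational as ℚ
import Data.Rational.Properties as ℚ
import Data.Rational.Unnormalised as ℚᵘ
import Data.Rational.Unnormalised.Properties as ℚᵘ

indicator : Bool → ℕ
indicator b = if b then 1 else 0

countC-+ : ∀ {P Q R : Literal → Bool} → (∀ l → indicator (P l) ≡ indicator (Q l) + indicator (R l)) →
           ∀ ls → countC P ls ≡ countC Q ls + countC R ls
countC-+ h [] = refl
countC-+ {Q = Q} {R} h (l ∷ ls) rewrite h l | countC-+ h ls =
  interchange (indicator (Q l)) (indicator (R l)) (countC Q ls) (countC R ls)

countC-cong : ∀ {P Q : Literal → Bool} → (∀ l → P l ≡ Q l) → ∀ ls → countC P ls ≡ countC Q ls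
countC-cong h [] = refl
countC-cong h (l ∷ ls) = cong₂ _+_ (cong indicator (h l)) (countC-cong h ls)

countC-false : ∀ ls → countC (λ _ → false) ls ≡ 0
countC-false [] = refl
countC-false (l ∷ ls) = countC-false ls

countC-∧ˡ : ∀ b (P : Literal → Bool) ls → countC (λ l → b ∧ P l) ls ≡ (if b then countC P ls else 0)
countC-∧ˡ true P ls = refl
countC-∧ˡ false P ls = countC-false ls

countC-++ : ∀ (P : Literal → Bool) xs ys → countC P (xs ++ ys) ≡ countC P xs + countC P ys
countC-++ P [] ys = refl
countC-++ P (l ∷ xs) ys =
  trans (cong (indicator (P l) +_) (countC-++ P xs ys)) (sym (ℕ.+-assoc (indicator (P l)) _ _))

countC-map : ∀ (P : Literal → Bool) f ls → countC P (map f ls) ≡ countC (P ∘ f) ls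
countC-map P f [] = refl
countC-map P f (l ∷ ls) = cong (indicator (P (f l)) +_) (countC-map P f ls)

count≡countC-concat : ∀ (P : Literal → Bool) S → count P S ≡ countC P (concat S)
count≡countC-concat P [] = refl
count≡countC-concat P (c ∷ S) =
  trans (cong (countC P c +_) (count≡countC-concat P S)) (sym (countC-++ P c (concat S)))

count-invert : ∀ (P : Literal → Bool) θ S → count P (invert S θ) ≡ count (P ∘ invertLit θ) S
count-invert P θ [] = refl
count-invert P θ (c ∷ S) = cong₂ _+_ (countC-map P (invertLit θ) c) (count-invert P θ S)

count-+ : ∀ {P Q R : Literal → Bool} → (∀ l → indicator (P l) ≡ indicator (Q l) + indicator (R l)) →
          ∀ S → count P S ≡ count Q S + count R S
count-+ h [] = refl
count-+ {Q = Q} {R} h (c ∷ S) rewrite countC-+ h c | count-+ h S =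
  interchange (countC Q c) (countC R c) (count Q S) (count R S)

atVar : Var → (Literal → Bool) → Literal → Bool
atVar v X l = (var l ≡ᵇ v) ∧ X l

onVars : (Var → Bool) → (Literal → Bool) → Literal → Bool
onVars q X l = q (var l) ∧ X l

indicator-<ᵇ-suc : ∀ v k → indicator (v <ᵇ suc k) ≡ indicator (v <ᵇ k) + indicator (v ≡ᵇ k)
indicator-<ᵇ-suc zero zero = refl
indicator-<ᵇ-suc zero (suc k) = refl
indicator-<ᵇ-suc (suc v) zero = refl
indicator-<ᵇ-suc (suc v) (suc k) = indicator-<ᵇ-suc v k

indicator-∧ˡ-+ : ∀ a {x y z} → indicator x ≡ indicator y + indicator z →
                 indicator (a ∧ x) ≡ indicator (a ∧ y) + indicator (a ∧ z)
indicator-∧ˡ-+ true h = h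
indicator-∧ˡ-+ false h = refl

countC-below-zero : ∀ (P : Literal → Bool) ls → countC (λ l → P l ∧ (var l <ᵇ 0)) ls ≡ 0
countC-below-zero P ls = trans (countC-cong (λ l → ∧-zeroʳ (P l)) ls) (countC-false ls)

countC-below-suc : ∀ (P : Literal → Bool) k ls →
  countC (λ l → P l ∧ (var l <ᵇ suc k)) ls ≡
  countC (λ l → P l ∧ (var l <ᵇ k)) ls + countC (λ l → P l ∧ (var l ≡ᵇ k)) ls
countC-below-suc P k = countC-+ (λ l → indicator-∧ˡ-+ (P l) (indicator-<ᵇ-suc (var l) k))

onVars-∧-≡ᵇ : ∀ q X k l → onVars q X l ∧ (var l ≡ᵇ k) ≡ q k ∧ atVar k X l
onVars-∧-≡ᵇ q X k l with var l ≡ᵇ k in eq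
... | true rewrite ≡ᵇ⇒≡ (var l) k (subst T (sym eq) _) = ∧-identityʳ (q k ∧ X l)
... | false = trans (∧-zeroʳ (q (var l) ∧ X l)) (sym (∧-zeroʳ (q k)))

countC-onVars-at : ∀ q X k ls →
  countC (λ l → onVars q X l ∧ (var l ≡ᵇ k)) ls ≡ (if q k then countC (atVar k X) ls else 0)
countC-onVars-at q X k ls = trans (countC-cong (onVars-∧-≡ᵇ q X k) ls) (countC-∧ˡ (q k) (atVar k X) ls)

countC-below-bounded : ∀ (P : Literal → Bool) {k} ls → All (λ l → var l < k) ls →
                       countC (λ l → P l ∧ (var l <ᵇ k)) ls ≡ countC P ls
countC-below-bounded P [] [] = refl
countC-below-bounded P {k} (l ∷ ls) (l<k ∷ ls<k) =
  cong₂ _+_ (cong indicator P∧l<k≡P) (countC-below-bounded P ls ls<k)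
  where
  P∧l<k≡P : P l ∧ (var l <ᵇ k) ≡ P l
  P∧l<k≡P = trans (cong (P l ∧_) (Equivalence.to T-≡ (<⇒<ᵇ l<k))) (∧-identityʳ (P l))

vars-bounded : ∀ ls → ∃[ k ] All (λ l → var l < k) ls
vars-bounded [] = 0 , []
vars-bounded (l ∷ ls) with vars-bounded ls
... | k , ls<k =
  suc (var l) ⊔ k , m≤m⊔n (suc (var l)) k ∷ All.map (λ l'<k → <-≤-trans l'<k (m≤n⊔m _ k)) ls<k

module _ (q : Var → Bool) (X Y : Literal → Bool) (ls : List Literal)
         (atVar-≤ : ∀ v → T (q v) → countC (atVar v X) ls ℕ.≤ countC (atVar v Y) ls) where

  -- The per-variable inequalities are summed over the variables below k, by induction on k.
  private
    countC-onVars-below-≤ : ∀ k → countC (λ l → onVars q X l ∧ (var l <ᵇ k)) ls ℕ.≤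
                                   countC (λ l → onVars q Y l ∧ (var l <ᵇ k)) ls
    countC-onVars-below-≤ zero = ≤-reflexive (trans (countC-below-zero (onVars q X) ls)
                                                    (sym (countC-below-zero (onVars q Y) ls)))
    countC-onVars-below-≤ (suc k) = begin
      countC (λ l → onVars q X l ∧ (var l <ᵇ suc k)) ls
        ≡⟨ countC-below-suc (onVars q X) k ls ⟩
      countC (λ l → onVars q X l ∧ (var l <ᵇ k)) ls + countC (λ l → onVars q X l ∧ (var l ≡ᵇ k)) ls
        ≤⟨ +-mono-≤ (countC-onVars-below-≤ k) at-k ⟩
      countC (λ l → onVars q Y l ∧ (var l <ᵇ k)) ls + countC (λ l → onVars q Y l ∧ (var l ≡ᵇ k)) ls
        ≡⟨ countC-below-suc (onVars q Y) k ls ⟨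
      countC (λ l → onVars q Y l ∧ (var l <ᵇ suc k)) ls ∎
      where
      open ℕ.≤-Reasoning
      if-≤ : ∀ b → (T b → countC (atVar k X) ls ℕ.≤ countC (atVar k Y) ls) →
             (if b then countC (atVar k X) ls else 0) ℕ.≤ (if b then countC (atVar k Y) ls else 0)
      if-≤ true h = h _
      if-≤ false h = z≤n
      at-k : countC (λ l → onVars q X l ∧ (var l ≡ᵇ k)) ls ℕ.≤
             countC (λ l → onVars q Y l ∧ (var l ≡ᵇ k)) ls
      at-k = subst₂ ℕ._≤_ (sym (countC-onVars-at q X k ls)) (sym (countC-onVars-at q Y k ls))
                    (if-≤ (q k) (atVar-≤ k))

  countC-onVars-≤ : countC (onVars q X) ls ℕ.≤ countC (onVars q Y) ls
  countC-onVars-≤ with vars-bounded ls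
  ... | k , ls<k = subst₂ ℕ._≤_ (countC-below-bounded (onVars q X) ls ls<k)
                                (countC-below-bounded (onVars q Y) ls ls<k)
                                (countC-onVars-below-≤ k)

count-onVars-≤ : ∀ q (X Y : Literal → Bool) S →
                 (∀ v → T (q v) → count (atVar v X) S ℕ.≤ count (atVar v Y) S) →
                 count (onVars q X) S ℕ.≤ count (onVars q Y) S
count-onVars-≤ q X Y S atVar-≤ =
  subst₂ ℕ._≤_ (sym (count≡countC-concat (onVars q X) S)) (sym (count≡countC-concat (onVars q Y) S))
    (countC-onVars-≤ q X Y (concat S) λ v qv →
      subst₂ ℕ._≤_ (count≡countC-concat (atVar v X) S) (count≡countC-concat (atVar v Y) S) (atVar-≤ v qv))

size : ClauseSet → ℕ
size = count (λ _ → true)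

poslit+neglit≡size : ∀ S → poslit S + neglit S ≡ size S
poslit+neglit≡size S = sym (count-+ (λ l → indicator-true (positive l)) S)
  where
  indicator-true : ∀ b → indicator true ≡ indicator b + indicator (not b)
  indicator-true true = refl
  indicator-true false = refl

size-invert : ∀ S θ → size (invert S θ) ≡ size S
size-invert S θ = count-invert (λ _ → true) θ S

negative : Literal → Bool
negative = not ∘ positive

indicator-split : ∀ a b → indicator b ≡ indicator (not a ∧ b) + indicator (a ∧ b)
indicator-split true b = refl
indicator-split false b = sym (ℕ.+-identityʳ (indicator b))

indicator-select : ∀ a x y → indicator (if a then y else x) ≡ indicator (not a ∧ x) + indicator (a ∧ y)
indicator-select true x y = refl
indicator-select false x y = sym (ℕ.+-identityʳ (indicator x))

skewness-suc : ∀ S k → poslit S + neglit S ≡ suc k → skewness S ≡ (ℤ.+ (poslit S ⊓ neglit S)) ℚ./ suc k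
skewness-suc S k eq with poslit S + neglit S | eq
... | .(suc k) | refl = refl

skewness-zero : ∀ S → poslit S + neglit S ≡ 0 → skewness S ≡ ℚ.0ℚ
skewness-zero S eq with poslit S + neglit S | eq
... | .0 | refl = refl

/-monoˡ-≤ : ∀ {m n} k → m ℕ.≤ n → (ℤ.+ m) ℚ./ suc k ≤ (ℤ.+ n) ℚ./ suc k
-- (+ m) / suc k is definitionally fromℚᵘ (mkℚᵘ (+ m) k).
/-monoˡ-≤ {m} {n} k m≤n = ℚ.toℚᵘ-cancel-≤
  (ℚᵘ.≤-respˡ-≃ (ℚᵘ.≃-sym (ℚ.toℚᵘ-fromℚᵘ (ℚᵘ.mkℚᵘ (ℤ.+ m) k)))
  (ℚᵘ.≤-respʳ-≃ (ℚᵘ.≃-sym (ℚ.toℚᵘ-fromℚᵘ (ℚᵘ.mkℚᵘ (ℤ.+ n) k)))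
  (ℚᵘ.*≤* (ℤ.*-monoʳ-≤-nonNeg (ℤ.+ suc k) (ℤ.+≤+ m≤n)))))

skewness-mono : ∀ S₁ S₂ → poslit S₁ + neglit S₁ ≡ poslit S₂ + neglit S₂ →
                poslit S₁ ⊓ neglit S₁ ℕ.≤ poslit S₂ ⊓ neglit S₂ → skewness S₁ ≤ skewness S₂
skewness-mono S₁ S₂ sum≡ min≤ with poslit S₂ + neglit S₂
... | zero = ℚ.≤-reflexive (skewness-zero S₁ sum≡)
... | suc k = subst (_≤ _) (sym (skewness-suc S₁ k sum≡)) (/-monoˡ-≤ k min≤)

skewness-invert-≤ : ∀ θ S →
  (∀ v → T (θ v) → neg v S ℕ.≤ pos v S) → (∀ v → T (not (θ v)) → pos v S ℕ.≤ neg v S) →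
  skewness (invert S θ) ≤ skewness S
skewness-invert-≤ θ S neg≤pos pos≤neg = skewness-mono (invert S θ) S sum≡ min≤
  where
  posOut posIn negOut negIn : ℕ
  posOut = count (onVars (not ∘ θ) positive) S
  posIn  = count (onVars θ positive) S
  negOut = count (onVars (not ∘ θ) negative) S
  negIn  = count (onVars θ negative) S

  negIn≤posIn : negIn ℕ.≤ posIn
  negIn≤posIn = count-onVars-≤ θ negative positive S neg≤pos

  posOut≤negOut : posOut ℕ.≤ negOut
  posOut≤negOut = count-onVars-≤ (not ∘ θ) positive negative S pos≤neg

  poslit-S : poslit S ≡ posOut + posIn
  poslit-S = count-+ (λ l → indicator-split (θ (var l)) (positive l)) S

  neglit-S : neglit S ≡ negOut + negIn
  neglit-S = count-+ (λ l → indicator-split (θ (var l)) (negative l)) S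

  poslit-Sθ : poslit (invert S θ) ≡ posOut + negIn
  poslit-Sθ = trans (count-invert positive θ S)
                    (count-+ (λ l → indicator-select (θ (var l)) (positive l) (negative l)) S)

  sum≡ : poslit (invert S θ) + neglit (invert S θ) ≡ poslit S + neglit S
  sum≡ = begin
    poslit (invert S θ) + neglit (invert S θ) ≡⟨ poslit+neglit≡size (invert S θ) ⟩
    size (invert S θ)                         ≡⟨ size-invert S θ ⟩
    size S                                    ≡⟨ poslit+neglit≡size S ⟨
    poslit S + neglit S                       ∎
    where open ≡-Reasoning

  min≤ : poslit (invert S θ) ⊓ neglit (invert S θ) ℕ.≤ poslit S ⊓ neglit S
  min≤ = ≤-trans (m⊓n≤m _ _) (⊓-glb
    (subst₂ ℕ._≤_ (sym poslit-Sθ) (sym poslit-S) (+-monoʳ-≤ posOut negIn≤posIn))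
    (subst₂ ℕ._≤_ (sym poslit-Sθ) (sym neglit-S) (+-monoˡ-≤ negIn posOut≤negOut)))

neg≤pos-in-ρ : ∀ S v → T (ρ S v) → neg v S ℕ.≤ pos v S
neg≤pos-in-ρ S v v∈ρ = <⇒≤ (<ᵇ⇒< (neg v S) (pos v S) v∈ρ)

pos≤neg-outside-ρ : ∀ S v → T (not (ρ S v)) → pos v S ℕ.≤ neg v S
pos≤neg-outside-ρ S v v∉ρ = ≮⇒≥ (λ neg<pos → subst T (Equivalence.to T-not-≡ v∉ρ) (<⇒<ᵇ neg<pos))

proposition5p1 : (S : ClauseSet) → 0 < poslit S + neglit S → hiddenSkewness S ≤ skewness S
proposition5p1 S _ = skewness-invert-≤ (ρ S) S (neg≤pos-in-ρ S) (pos≤neg-outside-ρ S)
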